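{- Let $n \in \mathbb{N}$ and let $\mathcal{F}$ be a shellable family of subsets of $[n]$ with $|\mathcal{F}| = n$. Let $S \subseteq [n]$ be the set of elements $k \in [n]$ such that $k \in F$ for exactly one member $F$ of $\mathcal{F}$. Then $S$ is not empty.
   Context: $\mathbb{N}$ denotes the positive integers and $[n]=\{1,\dots,n\}$. Families of sets are treated as multisets (members counted with multiplicity), so $|\mathcal{F}|$ is the number of members counted with multiplicity, and "exactly one member" is counted with multiplicity. A finite family $\mathcal{F}$ of subsets of $[n]$ with $m=|\mathcal{F}|$ is called shellable if there is a bijection $\sigma_{\mathcal{F}}:[m]\to\mathcal{F}$ (i.e., an ordering $F_1,\dots,F_m$ of its members) such that for every $k\in[m]$, $\left|\bigcup_{i=1}^k \sigma_{\mathcal{F}}(i)\right| = k$. -}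

module Defs where

open import Data.Nat using (ℕ; suc; _≤?_)
open import Data.Bool using (Bool; true; false)
open import Data.Fin using (Fin; toℕ)
open import Data.Fin.Subset using (Subset; ⋃; ∣_∣)
open import Data.Fin.Subset.Properties using (_∈?_)
open import Data.Fin.Permutation using (Permutation′; _⟨$⟩ʳ_)
open import Data.List using (List; map; filter; length)
open import Data.List.Base using ()
open import Data.Vec using (tabulate)
open import Data.Vec.Functional using ()
open import Data.Fin.Base using ()
open import Data.Product using (∃)
open import Relation.Binary.PropositionalEquality using (_≡_)
open import Relation.Nullary.Decidable using (does)
open import Data.List using (allFin) public

-- A family of m subsets of [n] (a multiset, members indexed by Fin m;
-- repetitions allowed).
Family : ℕ → ℕ → Set
Family m n = Fin m → Subset n

prefixUnion : ∀ {m n} → Family m n → Permutation′ m → Fin m → Subset n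
prefixUnion {m} F σ k =
  ⋃ (map (λ i → F (σ ⟨$⟩ʳ i)) (filter (λ i → toℕ i ≤? toℕ k) (allFin m)))

-- Shellable: some ordering F_{σ(1)},...,F_{σ(m)} of the members such that
-- for every k ∈ [m] the union of the first k members has exactly k elements.
-- (Here position k : Fin m is 0-based, so "first k" is positions 0..k and
--  the required size is suc (toℕ k).)
Shellable : ∀ {m n} → Family m n → Set
Shellable {m} F = ∃ λ (σ : Permutation′ m) →
  ∀ (k : Fin m) → ∣ prefixUnion F σ k ∣ ≡ suc (toℕ k)

memberCount : ∀ {m n} → Family m n → Fin n → ℕ
memberCount {m} F x = length (filter (λ i → x ∈? F i) (allFin m))

uniqueElems : ∀ {m n} → Family m n → Subset n
uniqueElems F = tabulate λ x → does (memberCount F x Data.Nat.≟ 1)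
  where import Data.Nat

-- In a shelling F₁, …, Fₘ each prefix union grows by exactly one element, so
-- the last member Fₘ contains an element lying in no earlier member.  That
-- element then lies in Fₘ and in no other member of the family.
module Submission where

open import Defs
open import Data.Nat using (ℕ; suc; s≤s⁻¹)
import Data.Nat as ℕ
open import Data.Nat.Properties using (≮⇒≥; <-trans; n<1+n)
open import Data.Fin using (Fin; zero; suc; toℕ; fromℕ; inject₁; _≤_; _<_)
open import Data.Fin.Properties using (toℕ-inject₁; ≤fromℕ; ≤-antisym)
open import Data.Fin.Subset
  using (Subset; Nonempty; ⋃; ∣_∣; _∈_; _∉_; ⊥; inside; outside)
open import Data.Fin.Subset.Properties
  using (_∈?_; x∈p∪q⁻; x∈p∪q⁺; ∉⊥; ∣⊥∣≡0; drop-there)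
open import Data.Fin.Permutation using (Permutation′; _⟨$⟩ʳ_; _⟨$⟩ˡ_; inverseʳ)
open import Data.List using (List; []; _∷_; map; filter; length)
open import Data.List.Properties using (filter-none)
import Data.List.Relation.Unary.All as All
open import Data.List.Relation.Unary.Any using (here; there)
open import Data.List.Relation.Unary.AllPairs using (_∷_)
open import Data.List.Relation.Unary.Unique.Propositional using (Unique)
open import Data.List.Relation.Unary.Unique.Propositional.Properties using (allFin⁺)
open import Data.List.Membership.Propositional using () renaming (_∈_ to _∈ₗ_)
open import Data.List.Membership.Propositional.Properties
  using (∈-map⁺; ∈-map⁻; ∈-filter⁺; ∈-filter⁻; ∈-allFin)
open import Data.Vec using ([]; _∷_; here; there; lookup)
open import Data.Vec.Properties using (lookup⇒[]=; lookup∘tabulate)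
open import Data.Product using (∃; _×_; _,_; proj₂)
open import Data.Sum using (inj₁; inj₂)
open import Relation.Nullary using (yes; no; contradiction)
open import Relation.Nullary.Decidable using (does)
open import Relation.Unary using (Decidable)
open import Data.Bool using (true)
open import Function using (_∘_)
open import Relation.Binary.PropositionalEquality
  using (_≡_; refl; sym; trans; cong; subst; subst₂; module ≡-Reasoning)
open ≡-Reasoning

∈-⋃⁻ : ∀ {n} {x : Fin n} (ps : List (Subset n)) →
       x ∈ ⋃ ps → ∃ λ p → p ∈ₗ ps × x ∈ p
∈-⋃⁻ []       x∈⋃ = contradiction x∈⋃ ∉⊥
∈-⋃⁻ (p ∷ ps) x∈⋃ with x∈p∪q⁻ p (⋃ ps) x∈⋃
... | inj₁ x∈p = p , here refl , x∈p
... | inj₂ x∈⋃ps with ∈-⋃⁻ ps x∈⋃ps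
...   | q , q∈ps , x∈q = q , there q∈ps , x∈q

∈-⋃⁺ : ∀ {n} {x : Fin n} {p} {ps : List (Subset n)} →
       p ∈ₗ ps → x ∈ p → x ∈ ⋃ ps
∈-⋃⁺ (here refl) x∈p = x∈p∪q⁺ (inj₁ x∈p)
∈-⋃⁺ (there p∈ps) x∈p = x∈p∪q⁺ (inj₂ (∈-⋃⁺ p∈ps x∈p))

∃∈q∉p-∷ : ∀ {n} {p q : Subset n} {s t} →
          (∃ λ x → x ∈ q × x ∉ p) → ∃ λ x → x ∈ t ∷ q × x ∉ s ∷ p
∃∈q∉p-∷ (x , x∈q , x∉p) = suc x , there x∈q , λ x∈p → x∉p (drop-there x∈p)

∣p∣<∣q∣⇒∃∈q∉p : ∀ {n} (p q : Subset n) → ∣ p ∣ ℕ.< ∣ q ∣ → ∃ λ x → x ∈ q × x ∉ p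
∣p∣<∣q∣⇒∃∈q∉p []            []            ()
∣p∣<∣q∣⇒∃∈q∉p (outside ∷ p) (inside  ∷ q) _  = zero , here , λ ()
∣p∣<∣q∣⇒∃∈q∉p (outside ∷ p) (outside ∷ q) lt = ∃∈q∉p-∷ (∣p∣<∣q∣⇒∃∈q∉p p q lt)
∣p∣<∣q∣⇒∃∈q∉p (inside  ∷ p) (inside  ∷ q) lt = ∃∈q∉p-∷ (∣p∣<∣q∣⇒∃∈q∉p p q (s≤s⁻¹ lt))
∣p∣<∣q∣⇒∃∈q∉p (inside  ∷ p) (outside ∷ q) lt =
  ∃∈q∉p-∷ (∣p∣<∣q∣⇒∃∈q∉p p q (<-trans (n<1+n ∣ p ∣) lt))

length-filter≡1 : ∀ {A : Set} {P : A → Set} (P? : Decidable P) {xs : List A} {j : A} →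
                  Unique xs → j ∈ₗ xs → P j → (∀ {k} → P k → k ≡ j) →
                  length (filter P? xs) ≡ 1
length-filter≡1 P? {y ∷ ys} (y∉ys ∷ _) (here refl) Py onlyY with P? y
... | no ¬Py = contradiction Py ¬Py
... | yes _  = cong (suc ∘ length) (filter-none P? (All.map (λ y≢k Pk → y≢k (sym (onlyY Pk))) y∉ys))
length-filter≡1 P? {y ∷ ys} (y∉ys ∷ uniq) (there j∈ys) Pj onlyJ with P? y
... | no _   = length-filter≡1 P? uniq j∈ys Pj onlyJ
... | yes Py = contradiction (onlyJ Py) (All.lookup y∉ys j∈ys)

module _ {m n} (F : Family m n) where

  memberCount≡1 : ∀ {x j} → x ∈ F j → (∀ {k} → x ∈ F k → k ≡ j) → memberCount F x ≡ 1
  memberCount≡1 {x} = length-filter≡1 (λ i → x ∈? F i) (allFin⁺ m) (∈-allFin _)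

  memberCount≡1⇒∈uniqueElems : ∀ {x} → memberCount F x ≡ 1 → x ∈ uniqueElems F
  memberCount≡1⇒∈uniqueElems {x} count≡1 = lookup⇒[]= x (uniqueElems F) (begin
    lookup (uniqueElems F) x       ≡⟨ lookup∘tabulate _ x ⟩
    does (memberCount F x ℕ.≟ 1)   ≡⟨ cong (λ c → does (c ℕ.≟ 1)) count≡1 ⟩
    true                           ∎)

  module _ (σ : Permutation′ m) where

    ∈-prefixUnion⁻ : ∀ {k x} → x ∈ prefixUnion F σ k → ∃ λ i → i ≤ k × x ∈ F (σ ⟨$⟩ʳ i)
    ∈-prefixUnion⁻ {k} x∈U
      with ∈-⋃⁻ (map (λ i → F (σ ⟨$⟩ʳ i)) (filter (λ i → toℕ i ℕ.≤? toℕ k) (allFin m))) x∈U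
    ... | _ , p∈ , x∈p with ∈-map⁻ (λ i → F (σ ⟨$⟩ʳ i)) p∈
    ...   | i , i∈ , refl = i , proj₂ (∈-filter⁻ (λ i → toℕ i ℕ.≤? toℕ k) {xs = allFin m} i∈) , x∈p

    ∈-prefixUnion⁺ : ∀ {k i x} → i ≤ k → x ∈ F (σ ⟨$⟩ʳ i) → x ∈ prefixUnion F σ k
    ∈-prefixUnion⁺ {k} i≤k = ∈-⋃⁺ (∈-map⁺ _ (∈-filter⁺ (λ i → toℕ i ℕ.≤? toℕ k) (∈-allFin _) i≤k))

module _ {m n} (F : Family (suc m) n) (σ : Permutation′ (suc m))
         (shelling : ∀ k → ∣ prefixUnion F σ k ∣ ≡ suc (toℕ k)) where

  ∣⊥∣<∣prefixUnion₀∣ : ∣ ⊥ {n} ∣ ℕ.< ∣ prefixUnion F σ zero ∣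
  ∣⊥∣<∣prefixUnion₀∣ = subst₂ ℕ._<_ (sym (∣⊥∣≡0 n)) (sym (shelling zero)) (n<1+n 0)

  ∣prefixUnion∣-grows : ∀ k → ∣ prefixUnion F σ (inject₁ k) ∣ ℕ.< ∣ prefixUnion F σ (suc k) ∣
  ∣prefixUnion∣-grows k = subst₂ ℕ._<_ (sym ∣Uₖ∣≡1+k) (sym (shelling (suc k))) (n<1+n _)
    where
      ∣Uₖ∣≡1+k : ∣ prefixUnion F σ (inject₁ k) ∣ ≡ suc (toℕ k)
      ∣Uₖ∣≡1+k = trans (shelling (inject₁ k)) (cong suc (toℕ-inject₁ k))

  shelling-fresh : ∀ k → ∃ λ x → x ∈ prefixUnion F σ k × (∀ {i} → i < k → x ∉ F (σ ⟨$⟩ʳ i))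
  shelling-fresh zero with ∣p∣<∣q∣⇒∃∈q∉p ⊥ (prefixUnion F σ zero) ∣⊥∣<∣prefixUnion₀∣
  ... | x , x∈U₀ , _ = x , x∈U₀ , λ ()
  shelling-fresh (suc k) with ∣p∣<∣q∣⇒∃∈q∉p _ _ (∣prefixUnion∣-grows k)
  ... | x , x∈U , x∉Uₖ = x , x∈U , λ i<1+k x∈Fσi → x∉Uₖ (∈-prefixUnion⁺ F σ (i≤k i<1+k) x∈Fσi)
    where
      i≤k : ∀ {i} → i < suc k → i ≤ inject₁ k
      i≤k {i} i<1+k = subst (toℕ i ℕ.≤_) (sym (toℕ-inject₁ k)) (s≤s⁻¹ i<1+k)

lemma3p21 : (n : ℕ) → (F : Family (suc n) (suc n)) →
    Shellable F → Nonempty (uniqueElems F)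
lemma3p21 n F (σ , shelling) with shelling-fresh F σ shelling (fromℕ n)
... | x , x∈U , fresh with ∈-prefixUnion⁻ F σ x∈U
...   | i , _ , x∈Fσi = x , memberCount≡1⇒∈uniqueElems F (memberCount≡1 F x∈Fσi onlyMember)
  where
    atLast : ∀ {i} → x ∈ F (σ ⟨$⟩ʳ i) → i ≡ fromℕ n
    atLast {i} x∈Fσi = ≤-antisym (≤fromℕ i) (≮⇒≥ λ i<last → fresh i<last x∈Fσi)

    onlyMember : ∀ {j} → x ∈ F j → j ≡ σ ⟨$⟩ʳ i
    onlyMember {j} x∈Fj = begin
      j                      ≡⟨ sym (inverseʳ σ) ⟩
      σ ⟨$⟩ʳ (σ ⟨$⟩ˡ j)      ≡⟨ cong (σ ⟨$⟩ʳ_) (trans (atLast x∈Fσσ⁻¹j) (sym (atLast x∈Fσi))) ⟩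
      σ ⟨$⟩ʳ i               ∎
      where
        x∈Fσσ⁻¹j : x ∈ F (σ ⟨$⟩ʳ (σ ⟨$⟩ˡ j))
        x∈Fσσ⁻¹j = subst (λ j → x ∈ F j) (sym (inverseʳ σ)) x∈Fj
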